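{- Let $\mathcal{I}=(G,B,W,k)$ be an instance of \textsc{Blue-White Dominating Set}, and let $n=|V(G)|$. Let $G'$ be the graph obtained from $G$ by attaching $N=n^2$ distinct new pendant vertices to each vertex of $B$, and let $\mathcal{I}'=(G',k)$ be the resulting instance of \textsc{Dominating Set}. Then $\mathcal{I}$ is a yes-instance of \textsc{Blue-White Dominating Set} if and only if $\mathcal{I}'$ is a yes-instance of \textsc{Dominating Set}.
   Context: \textsc{Blue-White Dominating Set}: given a graph $G$ with $V(G)=B\uplus W$ and an integer $k\ge0$, decide whether there is $S\subseteq V(G)$ with $|S|\le k$ such that $S$ is a dominating set of $G$ (every vertex is in $S$ or adjacent to a vertex of $S$) and $B\subseteq S$. \textsc{Dominating Set}: given $(G,k)$, decide whether $G$ has a dominating set of size at most $k$. -}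

module Defs where

open import Data.Nat using (ℕ; _*_; _≤_)
open import Data.Fin using (Fin)
open import Data.Bool using (Bool; T)
open import Data.List using (List; length)
open import Data.List.Membership.Propositional using (_∈_)
open import Data.Product using (Σ; _×_; ∃; _,_)
open import Data.Sum using (_⊎_; inj₁; inj₂)
open import Data.Empty using (⊥)
open import Relation.Binary.PropositionalEquality using (_≡_)

-- A (simple, undirected) graph on vertex type V is given by an adjacency
-- relation; simplicity (symmetry, irreflexivity) is imposed as a hypothesis
-- where needed.

Dominating : {V : Set} → (V → V → Set) → List V → Set
Dominating {V} _~_ S = (v : V) → v ∈ S ⊎ ∃ λ u → u ∈ S × u ~ v

-- A list with duplicates only overestimates the size of the
-- underlying set, so "some list of length ≤ k" is exactly "some set of size ≤ k".
DSYes : {V : Set} → (V → V → Set) → ℕ → Set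
DSYes {V} _~_ k = Σ (List V) λ S → length S ≤ k × Dominating _~_ S

BWDSYes : {n : ℕ} → (Fin n → Fin n → Set) → (Fin n → Bool) → ℕ → Set
BWDSYes {n} E blue k =
  Σ (List (Fin n)) λ S → length S ≤ k × Dominating E S
    × ((v : Fin n) → T (blue v) → v ∈ S)

PendV : (n : ℕ) → (Fin n → Bool) → Set
PendV n blue = Fin n ⊎ (Σ (Fin n) (λ v → T (blue v)) × Fin (n * n))

data PendAdj {n : ℕ} (E : Fin n → Fin n → Set) (blue : Fin n → Bool)
     : PendV n blue → PendV n blue → Set where
  old   : ∀ {u v} → E u v → PendAdj E blue (inj₁ u) (inj₁ v)
  down  : ∀ {v} (b : T (blue v)) (i : Fin (n * n)) →
          PendAdj E blue (inj₁ v) (inj₂ ((v , b) , i))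
  up    : ∀ {v} (b : T (blue v)) (i : Fin (n * n)) →
          PendAdj E blue (inj₂ ((v , b) , i)) (inj₁ v)

{-# OPTIONS --safe #-}
module Submission where

-- A blue-white solution S dominates G' as it stands: blue vertices lie in S and
-- dominate their pendants. Conversely, project a dominating set of G' to G by
-- sending every pendant to the blue vertex it hangs from. This does not increase
-- the size, keeps G dominated (a pendant is adjacent in G' only to its anchor),
-- and contains every blue vertex, since some pendant of it must be dominated and
-- its only closed neighbourhood is itself and its anchor.

open import Defs
open import Data.Nat using (ℕ; suc; _*_; _≤_)
open import Data.Nat.Properties using (≤-trans; ≤-reflexive)
open import Data.Fin using (Fin; zero)
open import Data.Bool using (Bool; T)
open import Data.Empty using (⊥)
open import Data.List using (List; map; length)
open import Data.List.Properties using (length-map)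
open import Data.List.Membership.Propositional using (_∈_)
open import Data.List.Membership.Propositional.Properties using (∈-map⁺)
open import Data.Product using (_,_)
open import Data.Sum using (inj₁; inj₂)
open import Function.Bundles using (_⇔_; mk⇔)

length-map-≤ : {A B : Set} (f : A → B) (xs : List A) {k : ℕ} →
               length xs ≤ k → length (map f xs) ≤ k
length-map-≤ f xs = ≤-trans (≤-reflexive (length-map f xs))

-- Only positivity of N = n² matters, and Fin n being inhabited gives it.
pendantIndex : {n : ℕ} → Fin n → Fin (n * n)
pendantIndex {suc _} _ = zero

module _ {n : ℕ} (E : Fin n → Fin n → Set) (blue : Fin n → Bool) where

  anchor : PendV n blue → Fin n
  anchor (inj₁ u)             = u
  anchor (inj₂ ((v , _) , _)) = v

  inj₁-dominates : (S : List (Fin n)) → Dominating E S →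
                   ((v : Fin n) → T (blue v) → v ∈ S) →
                   Dominating (PendAdj E blue) (map inj₁ S)
  inj₁-dominates S dom blue⊆S (inj₁ v) with dom v
  ... | inj₁ v∈S           = inj₁ (∈-map⁺ inj₁ v∈S)
  ... | inj₂ (u , u∈S , e) = inj₂ (inj₁ u , ∈-map⁺ inj₁ u∈S , old e)
  inj₁-dominates S dom blue⊆S (inj₂ ((v , b) , i)) =
    inj₂ (inj₁ v , ∈-map⁺ inj₁ (blue⊆S v b) , down b i)

  anchor-dominates : (S : List (PendV n blue)) → Dominating (PendAdj E blue) S →
                     Dominating E (map anchor S)
  anchor-dominates S dom v with dom (inj₁ v)
  ... | inj₁ v∈S                    = inj₁ (∈-map⁺ anchor v∈S)
  ... | inj₂ (inj₁ u , u∈S , old e) = inj₂ (u , ∈-map⁺ anchor u∈S , e)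
  ... | inj₂ (inj₂ _ , p∈S , up _ _) = inj₁ (∈-map⁺ anchor p∈S)

  blue⊆anchors : (S : List (PendV n blue)) → Dominating (PendAdj E blue) S →
                 (v : Fin n) → T (blue v) → v ∈ map anchor S
  blue⊆anchors S dom v b with dom (inj₂ ((v , b) , pendantIndex v))
  ... | inj₁ p∈S                       = ∈-map⁺ anchor p∈S
  ... | inj₂ (inj₁ _ , v∈S , down _ _) = ∈-map⁺ anchor v∈S

  BWDSYes⇒DSYes : {k : ℕ} → BWDSYes E blue k → DSYes (PendAdj E blue) k
  BWDSYes⇒DSYes (S , |S|≤k , dom , blue⊆S) =
    map inj₁ S , length-map-≤ inj₁ S |S|≤k , inj₁-dominates S dom blue⊆S

  DSYes⇒BWDSYes : {k : ℕ} → DSYes (PendAdj E blue) k → BWDSYes E blue k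
  DSYes⇒BWDSYes (S , |S|≤k , dom) =
    map anchor S , length-map-≤ anchor S |S|≤k ,
    anchor-dominates S dom , blue⊆anchors S dom

lemma9 : (n : ℕ) (E : Fin n → Fin n → Set) (blue : Fin n → Bool) (k : ℕ) →
         (∀ u v → E u v → E v u) → (∀ v → E v v → ⊥) →
         BWDSYes E blue k ⇔ DSYes (PendAdj E blue) k
lemma9 n E blue k _ _ = mk⇔ (BWDSYes⇒DSYes E blue) (DSYes⇒BWDSYes E blue)
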